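{- Let $\mathcal P_1$ and $\mathcal P_2$ be non-empty finite posets such that $\mathcal P_1$ does not have a unique maximal element and $\mathcal P_2$ does not have a unique minimal element. Then for every $n$, $\text{sat}^*(n,\mathcal P_2*\mathcal P_1)\geq\max\{\text{sat}^*(n,\mathcal P_2*\bullet),\ \text{sat}^*(n,\bullet*\mathcal P_1)\}$.
   Context: A poset $\mathcal Q$ contains an induced copy of a poset $\mathcal P$ if there is an injective map $f:\mathcal P\to\mathcal Q$ with $f(x)\le f(y)$ iff $x\le y$. For a finite poset $\mathcal P$, a family $\mathcal F$ of subsets of $[n]$ (ordered by inclusion) is $\mathcal P$-saturated if $\mathcal F$ contains no induced copy of $\mathcal P$ but for every $S\subseteq[n]$ with $S\notin\mathcal F$, $\mathcal F\cup\{S\}$ contains an induced copy of $\mathcal P$; $\text{sat}^*(n,\mathcal P)$ is the minimum size of a $\mathcal P$-saturated family of subsets of $[n]$. For finite posets $\mathcal P_1,\mathcal P_2$, $\mathcal P_2*\mathcal P_1$ is the poset on the disjoint union of $\mathcal P_1$ and $\mathcal P_2$, keeping the orders within each, with every element of $\mathcal P_1$ strictly below every element of $\mathcal P_2$. $\bullet$ denotes the one-element poset. -}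

module Defs where

open import Data.Nat using (ℕ; _≤_)
open import Data.Fin using (Fin; splitAt; zero)
open import Data.Fin.Subset using (Subset; _⊆_)
open import Data.Sum using (_⊎_; inj₁; inj₂)
open import Data.Product using (Σ; _×_; ∃)
open import Data.List using (List; length; _∷_)
open import Data.List.Membership.Propositional using (_∈_; _∉_)
open import Data.List.Relation.Unary.Unique.Propositional using (Unique)
open import Data.Unit using (⊤)
open import Data.Empty using (⊥)
open import Relation.Binary.PropositionalEquality using (_≡_)
open import Relation.Nullary using (¬_)
open import Function.Definitions using (Injective)

-- A finite "poset" presented as a binary relation on Fin size.
-- (Partial-order axioms are imposed as hypotheses where needed.)
record FinRel : Set₁ where
  constructor mkFinRel
  field
    size : ℕ
    rel  : Fin size → Fin size → Set
open FinRel public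

bullet : FinRel
bullet = mkFinRel 1 (λ _ _ → ⊤)

joinRel : ∀ {a b} → (Fin a → Fin a → Set) → (Fin b → Fin b → Set)
        → Fin a ⊎ Fin b → Fin a ⊎ Fin b → Set
joinRel R₁ R₂ (inj₁ x) (inj₁ y) = R₁ x y
joinRel R₁ R₂ (inj₁ x) (inj₂ y) = ⊤
joinRel R₁ R₂ (inj₂ x) (inj₁ y) = ⊥
joinRel R₁ R₂ (inj₂ x) (inj₂ y) = R₂ x y

-- P₂ * P₁ : elements of P₁ (indices < size P₁) below all elements of P₂
_✶_ : FinRel → FinRel → FinRel
P₂ ✶ P₁ = mkFinRel (size P₁ Data.Nat.+ size P₂)
  (λ i j → joinRel (rel P₁) (rel P₂) (splitAt (size P₁) i) (splitAt (size P₁) j))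

-- A family of subsets of [n] (duplicate-freeness is required in IsSaturated)
Family : ℕ → Set
Family n = List (Subset n)

ContainsCopy : ∀ {n} → Family n → FinRel → Set
ContainsCopy {n} F P =
  Σ (Fin (size P) → Subset n) λ f →
    Injective _≡_ _≡_ f
    × (∀ x → f x ∈ F)
    × (∀ x y → (f x ⊆ f y → rel P x y) × (rel P x y → f x ⊆ f y))

IsSaturated : (n : ℕ) → FinRel → Family n → Set
IsSaturated n P F =
  Unique F
  × ¬ ContainsCopy F P
  × (∀ (S : Subset n) → S ∉ F → ContainsCopy (S ∷ F) P)

IsSatStar : ℕ → FinRel → ℕ → Set
IsSatStar n P m =
  (Σ (Family n) λ F → IsSaturated n P F × length F ≡ m)
  × (∀ F → IsSaturated n P F → m ≤ length F)

IsMaximal : (P : FinRel) → Fin (size P) → Set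
IsMaximal P x = ∀ y → rel P x y → y ≡ x

IsMinimal : (P : FinRel) → Fin (size P) → Set
IsMinimal P x = ∀ y → rel P y x → y ≡ x

HasUniqueMaximal : FinRel → Set
HasUniqueMaximal P = Σ (Fin (size P)) λ x → IsMaximal P x × (∀ y → IsMaximal P y → y ≡ x)

HasUniqueMinimal : FinRel → Set
HasUniqueMinimal P = Σ (Fin (size P)) λ x → IsMinimal P x × (∀ y → IsMinimal P y → y ≡ x)

module Submission where

open import Defs
open import Level using (0ℓ)
open import Data.Nat using (ℕ; zero; suc; _≤_; _⊔_; _≤?_)
open import Data.Nat.Properties using (⊔-lub; ≤-trans)
open import Data.Nat.Induction using (<-wellFounded)
open import Data.Fin using (Fin; zero; splitAt; join)
open import Data.Fin.Properties using (splitAt-join; join-splitAt)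
open import Data.Fin.Subset using (Subset; _⊆_; _⊂_; _⊃_; ⋃; ⋂; ∣_∣; ∁; inside; outside)
open import Data.Fin.Subset.Properties
  using (⊆-isPartialOrder; ⊆-trans; p⊆p∪q; q⊆p∪q; x∈p∪q⁻; ⊥⊆; p∩q⊆p; p∩q⊆q; x∈p∩q⁺; ⊆⊤;
         drop-∷-⊆; s⊂s; out⊂in; p⊂q⇒∣p∣<∣q∣; p⊂q⇒∁p⊃∁q)
open import Data.Product as Product using (Σ; ∃; _×_; _,_; proj₁; proj₂; uncurry)
open import Data.Sum as Sum using (_⊎_; inj₁; inj₂; [_,_])
open import Data.Sum.Properties using (inj₁-injective; inj₂-injective)
open import Data.Unit using (tt)
open import Data.Empty using (⊥-elim)
open import Data.Bool.Properties using () renaming (_≟_ to _≟ᵇ_)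
open import Data.Vec using (_∷_; []; here)
open import Data.Vec.Properties using (≡-dec)
open import Data.List using (List; _∷_; length; tabulate; filter)
open import Data.List.Properties using (length-filter)
open import Data.List.Membership.Propositional using (_∈_; _∉_)
open import Data.List.Membership.Propositional.Properties using (∈-tabulate⁺; ∈-filter⁺; ∈-filter⁻)
import Data.List.Membership.DecPropositional as DecMembership
open import Data.List.Relation.Unary.Any using (here; there; toSum; fromSum)
open import Data.List.Relation.Unary.All as All using (All; []; _∷_)
open import Data.List.Relation.Unary.All.Properties using (tabulate⁺)
open import Data.List.Relation.Unary.Unique.Propositional using (Unique)
open import Data.List.Relation.Unary.Unique.Propositional.Properties using (filter⁺)
open import Effect.Monad using (RawMonad)
open import Function using (_∘_; flip; id; _⇔_; mk⇔; Equivalence)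
open import Function.Construct.Composition using (_⇔-∘_)
open import Function.Definitions using (Injective)
open import Induction.WellFounded using (WellFounded; Acc; acc; module Subrelation)
open import Relation.Binary using (Rel; Antisymmetric; IsPartialOrder; DecidableEquality)
import Relation.Binary.Construct.Flip.EqAndOrd as Flip
import Relation.Binary.Construct.On as On
open import Relation.Binary.PropositionalEquality using (_≡_; _≢_; refl; sym; trans; cong; subst; subst₂)
open import Relation.Nullary using (¬_; Dec; yes; no; contradiction)
open import Relation.Nullary.Decidable using (¬¬-excluded-middle; decidable-stable; map′)
open import Relation.Nullary.Negation using (¬¬-Monad)
open import Relation.Unary using (Pred; Decidable; ｛_｝; _∪_)

-- Let F be (P₂ ✶ P₁)-saturated and call S ∈ F exposed if no copy of P₂ in F lies strictly
-- above S. The exposed sets form a (P₂ ✶ •)-saturated subfamily G of F, whence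
-- sat*(P₂ ✶ •) ≤ |G| ≤ |F|. No element of G lies below a copy of P₂ inside G, as such a copy
-- lies in F. Let S ∉ G. If some copy of P₂ in F lies above S, climbing through copies of P₂
-- (the order is well-founded upwards) yields one inside G. Otherwise S ∉ F, and saturation of F
-- puts S into a copy of P₂ ✶ P₁ in F ∪ {S}, necessarily into its P₂-half. The union m of the
-- P₁-half lies strictly below the whole P₂-half, because P₂ has no unique minimal element, and
-- descending from m (repeating the argument while m ∉ F) reaches an exposed J ⊆ m. Climbing
-- from the non-exposed members of the P₂-half gives a copy of P₂ in G ∪ {S} above J.
-- The bound for • ✶ P₁ is the same argument for the order ⊇.
-- All case distinctions are classical; as the conclusion is a decidable inequality, the
-- argument runs in the double-negation monad.

open RawMonad (¬¬-Monad {a = 0ℓ})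

op : FinRel → FinRel
op P = mkFinRel (size P) (flip (rel P))

-- Copies and stacks in an ordered set

module _ {X : Set} (_≼_ : Rel X 0ℓ) where

  Strict : Rel X 0ℓ
  Strict x y = x ≼ y × x ≢ y

  Faithful : {I : Set} → Rel I 0ℓ → (I → X) → Set
  Faithful r f = ∀ x y → (f x ≼ f y → r x y) × (r x y → f x ≼ f y)

  -- `ContainsCopy` as a record, so that P and Φ are inferable from a copy.
  record Copy (P : FinRel) (Φ : Pred X 0ℓ) : Set where
    constructor copy
    field
      embed     : Fin (size P) → X
      injective : Injective _≡_ _≡_ embed
      member    : ∀ x → Φ (embed x)
      faithful  : Faithful (rel P) embed

  open Copy public

  record Stacked (R Q : FinRel) (Φ : Pred X 0ℓ) : Set where
    constructor stacked
    field
      bottom     : Copy R Φ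
      top        : Copy Q Φ
      bottom≺top : ∀ i j → Strict (embed bottom i) (embed top j)

  record UnderCopy (Q : FinRel) (Φ : Pred X 0ℓ) (x : X) : Set where
    constructor under
    field
      cap   : Copy Q Φ
      x≺cap : ∀ j → Strict x (embed cap j)

  Exposed : FinRel → Pred X 0ℓ → Pred X 0ℓ
  Exposed Q Φ x = Φ x × ¬ UnderCopy Q Φ x

  IsStackSaturated : FinRel → FinRel → List X → Set
  IsStackSaturated R Q F =
    Unique F × ¬ Stacked R Q (_∈ F) × (∀ S → S ∉ F → Stacked R Q (_∈ S ∷ F))

containsCopy⇔copy : ∀ {n} {F : Family n} {P} → ContainsCopy F P ⇔ Copy _⊆_ P (_∈ F)
containsCopy⇔copy = mk⇔ (λ (f , inj , mem , faithful) → copy f inj mem faithful)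
                        (λ (copy f inj mem faithful) → f , inj , mem , faithful)

module _ {X : Set} {_≼_ : Rel X 0ℓ} where

  copy-flip : ∀ {P Φ} → Copy _≼_ P Φ → Copy (flip _≼_) (op P) Φ
  copy-flip (copy f inj mem faithful) = copy f inj mem λ x y → faithful y x

  stacked-flip : ∀ {R Q Φ} → Stacked _≼_ R Q Φ → Stacked (flip _≼_) (op Q) (op R) Φ
  stacked-flip (stacked cf cg f≺g) =
    stacked (copy-flip cg) (copy-flip cf) λ j i → proj₁ (f≺g i j) , proj₂ (f≺g i j) ∘ sym

stackSaturated-flip : ∀ {X} {_≼_ : Rel X 0ℓ} {R Q F} →
  IsStackSaturated _≼_ R Q F → IsStackSaturated (flip _≼_) (op Q) (op R) F
stackSaturated-flip (unique , free , saturated) =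
  unique , free ∘ stacked-flip , λ S S∉F → stacked-flip (saturated S S∉F)

join-injective : ∀ m n → Injective _≡_ _≡_ (join m n)
join-injective m n {s} {t} eq =
  trans (sym (splitAt-join m n s)) (trans (cong (splitAt m) eq) (splitAt-join m n t))

splitAt-injective : ∀ m n → Injective _≡_ _≡_ (splitAt m {n})
splitAt-injective m n {i} {j} eq =
  trans (sym (join-splitAt m n i)) (trans (cong (join m n) eq) (join-splitAt m n j))

module Order {X : Set} {_≼_ : Rel X 0ℓ} (≼-po : IsPartialOrder _≡_ _≼_) where

  open IsPartialOrder ≼-po using (antisym; ≲-respˡ-≈) renaming (refl to ≼-refl; trans to ≼-trans)
  open import Relation.Binary.Construct.NonStrictToStrict _≡_ _≼_ using (<-trans; ≤-<-trans)

  private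
    _≺_ : Rel X 0ℓ
    _≺_ = Strict _≼_

  ≺-trans : ∀ {x y z} → x ≺ y → y ≺ z → x ≺ z
  ≺-trans = <-trans ≼-po

  ≼-≺-trans : ∀ {x y z} → x ≼ y → y ≺ z → x ≺ z
  ≼-≺-trans = ≤-<-trans ≼-trans antisym ≲-respˡ-≈

  copy-mono : ∀ {P Φ Ψ} → (∀ {x} → Φ x → Ψ x) → Copy _≼_ P Φ → Copy _≼_ P Ψ
  copy-mono Φ⊆Ψ (copy f inj mem faithful) = copy f inj (Φ⊆Ψ ∘ mem) faithful

  underCopy-mono : ∀ {Q Φ Ψ x} → (∀ {y} → Φ y → Ψ y) → UnderCopy _≼_ Q Φ x → UnderCopy _≼_ Q Ψ x
  underCopy-mono Φ⊆Ψ (under c x≺c) = under (copy-mono Φ⊆Ψ c) x≺c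

  stacked-mono : ∀ {R Q Φ Ψ} → (∀ {x} → Φ x → Ψ x) → Stacked _≼_ R Q Φ → Stacked _≼_ R Q Ψ
  stacked-mono Φ⊆Ψ (stacked cf cg f≺g) = stacked (copy-mono Φ⊆Ψ cf) (copy-mono Φ⊆Ψ cg) f≺g

  copy-avoiding : ∀ {P Φ S} (c : Copy _≼_ P (｛ S ｝ ∪ Φ)) → (∀ i → S ≢ embed c i) → Copy _≼_ P Φ
  copy-avoiding (copy f inj mem faithful) S∉f =
    copy f inj (λ i → [ ⊥-elim ∘ S∉f i , id ] (mem i)) faithful

  underCopy-≼ : ∀ {Q Φ x y} → x ≼ y → UnderCopy _≼_ Q Φ y → UnderCopy _≼_ Q Φ x
  underCopy-≼ x≼y (under c y≺c) = under c λ j → ≼-≺-trans x≼y (y≺c j)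

  stacked-•⇔ : ∀ {Q Φ} → Stacked _≼_ bullet Q Φ ⇔ ∃ λ x → Φ x × UnderCopy _≼_ Q Φ x
  stacked-•⇔ = mk⇔
    (λ (stacked cf cg f≺g) → embed cf zero , member cf zero , under cg (f≺g zero))
    (λ (x , Φx , under cg x≺g) →
      stacked (copy (λ _ → x) (λ { {zero} {zero} _ → refl }) (λ _ → Φx) λ _ _ → (λ _ → tt) , (λ _ → ≼-refl))
              cg (λ _ → x≺g))

  module _ {R Q : FinRel} {Φ : Pred X 0ℓ} where
    private
      a = size R
      b = size Q

      _⊲_ : Rel (Fin a ⊎ Fin b) 0ℓ
      _⊲_ = joinRel (rel R) (rel Q)

      -- Copies of Q ✶ R re-indexed along splitAt.
      SumCopy : Set
      SumCopy = Σ (Fin a ⊎ Fin b → X) λ e → Injective _≡_ _≡_ e × (∀ s → Φ (e s)) × Faithful _≼_ _⊲_ e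

      copy⇒sumCopy : Copy _≼_ (Q ✶ R) Φ → SumCopy
      copy⇒sumCopy (copy f inj mem faithful) =
        f ∘ join a b , join-injective a b ∘ inj , mem ∘ join a b , faithful′
        where
          faithful′ : Faithful _≼_ _⊲_ (f ∘ join a b)
          faithful′ s t =
            let reflects , preserves = faithful (join a b s) (join a b t) in
            subst₂ _⊲_ (splitAt-join a b s) (splitAt-join a b t) ∘ reflects ,
            preserves ∘ subst₂ _⊲_ (sym (splitAt-join a b s)) (sym (splitAt-join a b t))

      sumCopy⇒copy : SumCopy → Copy _≼_ (Q ✶ R) Φ
      sumCopy⇒copy (e , inj , mem , faithful) =
        copy (e ∘ splitAt a) (splitAt-injective a b ∘ inj) (mem ∘ splitAt a)
             λ x y → faithful (splitAt a x) (splitAt a y)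

      sumCopy⇒stacked : SumCopy → Stacked _≼_ R Q Φ
      sumCopy⇒stacked (e , inj , mem , faithful) =
        stacked (copy (e ∘ inj₁) (inj₁-injective ∘ inj) (mem ∘ inj₁) λ x y → faithful (inj₁ x) (inj₁ y))
                (copy (e ∘ inj₂) (inj₂-injective ∘ inj) (mem ∘ inj₂) λ x y → faithful (inj₂ x) (inj₂ y))
                λ i j → proj₂ (faithful (inj₁ i) (inj₂ j)) tt , (λ ()) ∘ inj

      stacked⇒sumCopy : Stacked _≼_ R Q Φ → SumCopy
      stacked⇒sumCopy (stacked (copy f inj-f mem-f faithful-f) (copy g inj-g mem-g faithful-g) f≺g) =
        [ f , g ] , inj-fg , [ mem-f , mem-g ] , faithful-fg
        where
          inj-fg : Injective _≡_ _≡_ [ f , g ]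
          inj-fg {inj₁ x} {inj₁ y} eq = cong inj₁ (inj-f eq)
          inj-fg {inj₁ x} {inj₂ y} eq = ⊥-elim (proj₂ (f≺g x y) eq)
          inj-fg {inj₂ x} {inj₁ y} eq = ⊥-elim (proj₂ (f≺g y x) (sym eq))
          inj-fg {inj₂ x} {inj₂ y} eq = cong inj₂ (inj-g eq)

          faithful-fg : Faithful _≼_ _⊲_ [ f , g ]
          faithful-fg (inj₁ x) (inj₁ y) = faithful-f x y
          faithful-fg (inj₁ x) (inj₂ y) = (λ _ → tt) , (λ _ → proj₁ (f≺g x y))
          faithful-fg (inj₂ x) (inj₁ y) = (λ gx≼fy → proj₂ (f≺g y x) (antisym (proj₁ (f≺g y x)) gx≼fy)) , λ ()
          faithful-fg (inj₂ x) (inj₂ y) = faithful-g x y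

    copy-✶⇔stacked : Copy _≼_ (Q ✶ R) Φ ⇔ Stacked _≼_ R Q Φ
    copy-✶⇔stacked = mk⇔ (sumCopy⇒stacked ∘ copy⇒sumCopy) (sumCopy⇒copy ∘ stacked⇒sumCopy)

  -- If u were an element of the copy, it would be its least element, so that element of Q
  -- would be its unique minimal element.
  below-copy⇒strictly-below : ∀ {Q Φ u} → Antisymmetric _≡_ (rel Q) → ¬ HasUniqueMinimal Q →
    (c : Copy _≼_ Q Φ) → (∀ j → u ≼ embed c j) → ∀ j → u ≺ embed c j
  below-copy⇒strictly-below {Q} {u = u} Q-antisym Q-noUniqueMin (copy g _ _ faithful) u≼g j =
    u≼g j , λ u≡gj →
      Q-noUniqueMin (j , (λ k k≤j → Q-antisym k≤j (least u≡gj k)) , λ k k-min → sym (k-min j (least u≡gj k)))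
    where
      least : u ≡ g j → ∀ k → rel Q j k
      least u≡gj k = proj₁ (faithful j k) (subst (_≼ g k) u≡gj (u≼g k))

-- The exposed elements of a saturated family

¬¬-premise : {A B : Set} → (A → ¬ ¬ B) → ¬ ¬ (A → B)
¬¬-premise h k = k λ a → ⊥-elim (h a (k ∘ λ b _ → b))

¬¬-decidable-within : {A : Set} → DecidableEquality A → (P : Pred A 0ℓ) (xs : List A) →
  ¬ ¬ Decidable (λ x → x ∈ xs × P x)
¬¬-decidable-within _≟_ P xs = decide <$> All.sequenceM 0ℓ ¬¬-Monad (All.tabulate λ _ → ¬¬-excluded-middle)
  where
    open DecMembership _≟_ using (_∈?_)
    decide : All (Dec ∘ P) xs → Decidable (λ x → x ∈ xs × P x)
    decide P? x with x ∈? xs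
    ... | yes x∈xs = map′ (x∈xs ,_) proj₂ (All.lookup P? x∈xs)
    ... | no x∉xs = no (x∉xs ∘ proj₁)

module Exposure
  {X : Set} {_≼_ : Rel X 0ℓ} (≼-po : IsPartialOrder _≡_ _≼_)
  (≺-wf : WellFounded (Strict _≼_)) (≻-wf : WellFounded (flip (Strict _≼_)))
  (⋁ : List X → X)
  (⋁-upper : ∀ {x xs} → x ∈ xs → x ≼ ⋁ xs)
  (⋁-least : ∀ {u xs} → All (_≼ u) xs → ⋁ xs ≼ u)
  where

  open IsPartialOrder ≼-po using () renaming (refl to ≼-refl; trans to ≼-trans)
  open Order ≼-po

  private
    _≺_ : Rel X 0ℓ
    _≺_ = Strict _≼_

  underCopy⇒underExposedCopy : ∀ {Q Φ x} → UnderCopy _≼_ Q Φ x → ¬ ¬ UnderCopy _≼_ Q (Exposed _≼_ Q Φ) x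
  underCopy⇒underExposedCopy {Q} {Φ} {x} = climb (≻-wf x)
    where
      climb : ∀ {x} → Acc (flip _≺_) x → UnderCopy _≼_ Q Φ x → ¬ ¬ UnderCopy _≼_ Q (Exposed _≼_ Q Φ) x
      climb (acc rs) (under (copy g inj mem faithful) x≺g) =
        ¬¬-excluded-middle {A = ∃ λ j → UnderCopy _≼_ Q Φ (g j)} >>= λ where
          (yes (j , u)) → do
            under c gj≺c ← climb (rs (x≺g j)) u
            return (under c λ k → ≺-trans (x≺g j) (gj≺c k))
          (no ¬u) → return (under (copy g inj (λ j → mem j , λ u → ¬u (j , u)) faithful) x≺g)

  module Saturated
    {R Q : FinRel} (Q-antisym : Antisymmetric _≡_ (rel Q)) (Q-noUniqueMin : ¬ HasUniqueMinimal Q)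
    {Φ : Pred X 0ℓ} (Φ-free : ¬ Stacked _≼_ R Q Φ)
    (Φ-saturated : ∀ S → ¬ Φ S → Stacked _≼_ R Q (｛ S ｝ ∪ Φ))
    where

    AboveCopy : Pred X 0ℓ
    AboveCopy m = Σ (Copy _≼_ R Φ) λ c → ∀ i → embed c i ≼ m

    aboveCopy⇒¬underCopy : ∀ {x} → AboveCopy x → ¬ UnderCopy _≼_ Q Φ x
    aboveCopy⇒¬underCopy (cf , f≼x) (under cg x≺g) =
      Φ-free (stacked cf cg λ i j → ≼-≺-trans (f≼x i) (x≺g j))

    -- In the second case, m is the join of the bottom half, and S lies in the top half.
    stacked-insert : ∀ {S} → Stacked _≼_ R Q (｛ S ｝ ∪ Φ) →
      ¬ ¬ (UnderCopy _≼_ Q Φ S ⊎ Σ X λ m → AboveCopy m × UnderCopy _≼_ Q (｛ S ｝ ∪ Φ) m × m ≺ S)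
    stacked-insert {S} (stacked cf cg f≺g) =
      ¬¬-excluded-middle {A = ∃ λ i → S ≡ embed cf i} >>= λ where
        (yes (i , S≡fi)) → return (inj₁ (under
          (copy-avoiding cg λ j S≡gj → proj₂ (f≺g i j) (trans (sym S≡fi) S≡gj))
          λ j → subst (_≺ embed cg j) (sym S≡fi) (f≺g i j)))
        (no S∉f) → ¬¬-excluded-middle {A = ∃ λ j → S ≡ embed cg j} >>= λ where
          (no S∉g) → ⊥-elim (Φ-free (stacked (bottom-in-Φ S∉f) (copy-avoiding cg λ j → S∉g ∘ (j ,_)) f≺g))
          (yes (j , S≡gj)) → return (inj₂
            (join-f , (bottom-in-Φ S∉f , λ i → ⋁-upper (∈-tabulate⁺ i)) ,
             under cg join-f≺g , subst (join-f ≺_) (sym S≡gj) (join-f≺g j)))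
      where
        bottom-in-Φ : ¬ (∃ λ i → S ≡ embed cf i) → Copy _≼_ R Φ
        bottom-in-Φ S∉f = copy-avoiding cf λ i → S∉f ∘ (i ,_)

        join-f : X
        join-f = ⋁ (tabulate (embed cf))

        join-f≺g : ∀ j → join-f ≺ embed cg j
        join-f≺g = below-copy⇒strictly-below Q-antisym Q-noUniqueMin cg
                     λ j → ⋁-least (tabulate⁺ λ i → proj₁ (f≺g i j))

    exposed-below : ∀ {T} → AboveCopy T → ¬ ¬ (∃ λ J → Exposed _≼_ Q Φ J × J ≼ T)
    exposed-below {T} = descend (≺-wf T)
      where
        descend : ∀ {T} → Acc _≺_ T → AboveCopy T → ¬ ¬ (∃ λ J → Exposed _≼_ Q Φ J × J ≼ T)
        descend {T} (acc rs) above = ¬¬-excluded-middle {A = Φ T} >>= λ where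
          (yes ΦT) → return (T , (ΦT , aboveCopy⇒¬underCopy above) , ≼-refl)
          (no ¬ΦT) → stacked-insert (Φ-saturated T ¬ΦT) >>= λ where
            (inj₁ u) → ⊥-elim (aboveCopy⇒¬underCopy above u)
            (inj₂ (m , above-m , _ , m≺T)) → do
              (J , exposed , J≼m) ← descend (rs m≺T) above-m
              return (J , exposed , ≼-trans J≼m (proj₁ m≺T))

    exposed-saturated : ∀ S → ¬ Exposed _≼_ Q Φ S →
      ¬ ¬ (∃ λ x → (｛ S ｝ ∪ Exposed _≼_ Q Φ) x × UnderCopy _≼_ Q (｛ S ｝ ∪ Exposed _≼_ Q Φ) x)
    exposed-saturated S ¬exposed = ¬¬-excluded-middle {A = UnderCopy _≼_ Q Φ S} >>= λ where
        (yes u) → at-S u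
        (no ¬u) → stacked-insert (Φ-saturated S λ ΦS → ¬exposed (ΦS , ¬u)) >>= λ where
          (inj₁ u) → at-S u
          (inj₂ (m , above-m , under-m , _)) → do
            (J , exposed-J , J≼m) ← exposed-below above-m
            under-J ← underCopy-≼ J≼m <$> exposed-cap under-m
            return (J , inj₂ exposed-J , under-J)
      where
        Ψ : Pred X 0ℓ
        Ψ = ｛ S ｝ ∪ Exposed _≼_ Q Φ

        at-S : UnderCopy _≼_ Q Φ S → ¬ ¬ (∃ λ x → Ψ x × UnderCopy _≼_ Q Ψ x)
        at-S u = do
          u′ ← underCopy⇒underExposedCopy u
          return (S , inj₁ refl , underCopy-mono inj₂ u′)

        exposed-cap : ∀ {m} → UnderCopy _≼_ Q (｛ S ｝ ∪ Φ) m → ¬ ¬ UnderCopy _≼_ Q Ψ m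
        exposed-cap (under (copy g inj mem faithful) m≺g) =
          ¬¬-excluded-middle {A = ∃ λ j → UnderCopy _≼_ Q Φ (g j)} >>= λ where
            (yes (j , u)) → do
              u′ ← underCopy⇒underExposedCopy u
              return (underCopy-≼ (proj₁ (m≺g j)) (underCopy-mono inj₂ u′))
            (no ¬u) →
              return (under (copy g inj (λ j → Sum.map₂ (λ Φgj → Φgj , λ u → ¬u (j , u)) (mem j)) faithful) m≺g)

  stackSaturated-shrink :
    DecidableEquality X → ({P : Pred X 0ℓ} → (∀ x → ¬ ¬ P x) → ¬ ¬ (∀ x → P x)) →
    ∀ {R Q F} → Antisymmetric _≡_ (rel Q) → ¬ HasUniqueMinimal Q → IsStackSaturated _≼_ R Q F →
    ¬ ¬ (Σ (List X) λ G → IsStackSaturated _≼_ bullet Q G × length G ≤ length F)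
  stackSaturated-shrink _≟_ ¬¬-∀ {R} {Q} {F} Q-antisym Q-noUniqueMin (unique , free , saturated) =
    ¬¬-decidable-within _≟_ (¬_ ∘ UnderCopy _≼_ Q (_∈ F)) F >>= filterExposed
    where
      open Saturated Q-antisym Q-noUniqueMin free
        (λ S S∉F → stacked-mono (Sum.map₁ sym ∘ toSum) (saturated S S∉F))

      filterExposed : Decidable (Exposed _≼_ Q (_∈ F)) →
        ¬ ¬ (Σ (List X) λ G → IsStackSaturated _≼_ bullet Q G × length G ≤ length F)
      filterExposed exposed? = do
          saturated-G ← ¬¬-∀ λ S → ¬¬-premise (extend S)
          return (G , (filter⁺ exposed? unique , free-G , saturated-G) , length-filter exposed? F)
        where
          G : List X
          G = filter exposed? F

          ∈G⇒exposed : ∀ {x} → x ∈ G → Exposed _≼_ Q (_∈ F) x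
          ∈G⇒exposed = proj₂ ∘ ∈-filter⁻ exposed? {xs = F}

          exposed⇒∈G : ∀ {x} → Exposed _≼_ Q (_∈ F) x → x ∈ G
          exposed⇒∈G exposed = ∈-filter⁺ exposed? (proj₁ exposed) exposed

          free-G : ¬ Stacked _≼_ bullet Q (_∈ G)
          free-G st with Equivalence.to stacked-•⇔ st
          ... | x , x∈G , u = proj₂ (∈G⇒exposed x∈G) (underCopy-mono (proj₁ ∘ ∈G⇒exposed) u)

          extend : ∀ S → S ∉ G → ¬ ¬ Stacked _≼_ bullet Q (_∈ S ∷ G)
          extend S S∉G =
            Equivalence.from stacked-•⇔ ∘ into-S∷G <$> exposed-saturated S (S∉G ∘ exposed⇒∈G)
            where
              into : ∀ {y} → (｛ S ｝ ∪ Exposed _≼_ Q (_∈ F)) y → y ∈ S ∷ G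
              into = fromSum ∘ Sum.map sym exposed⇒∈G

              into-S∷G : (∃ λ x → (｛ S ｝ ∪ Exposed _≼_ Q (_∈ F)) x ×
                                   UnderCopy _≼_ Q (｛ S ｝ ∪ Exposed _≼_ Q (_∈ F)) x) →
                         ∃ λ x → x ∈ S ∷ G × UnderCopy _≼_ Q (_∈ S ∷ G) x
              into-S∷G (x , Ψx , u) = x , into Ψx , underCopy-mono into u

-- Subsets of [n]

module _ {n : ℕ} where

  ⊆-⋃ : ∀ {p : Subset n} {ps} → p ∈ ps → p ⊆ ⋃ ps
  ⊆-⋃ (here refl) = p⊆p∪q _
  ⊆-⋃ {ps = q ∷ _} (there p∈ps) = ⊆-trans (⊆-⋃ p∈ps) (q⊆p∪q q _)

  ⋃-⊆ : ∀ {q : Subset n} {ps} → All (_⊆ q) ps → ⋃ ps ⊆ q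
  ⋃-⊆ [] = ⊥⊆
  ⋃-⊆ {ps = p ∷ ps} (p⊆q ∷ ps⊆q) x∈⋃ = [ p⊆q , ⋃-⊆ ps⊆q ] (x∈p∪q⁻ p (⋃ ps) x∈⋃)

  ⋂-⊆ : ∀ {p : Subset n} {ps} → p ∈ ps → ⋂ ps ⊆ p
  ⋂-⊆ {ps = p ∷ ps} (here refl) = p∩q⊆p p (⋂ ps)
  ⋂-⊆ {ps = q ∷ ps} (there p∈ps) = ⊆-trans (p∩q⊆q q (⋂ ps)) (⋂-⊆ p∈ps)

  ⊆-⋂ : ∀ {q : Subset n} {ps} → All (q ⊆_) ps → q ⊆ ⋂ ps
  ⊆-⋂ [] = ⊆⊤
  ⊆-⋂ (q⊆p ∷ q⊆ps) x∈q = x∈p∩q⁺ (q⊆p x∈q , ⊆-⋂ q⊆ps x∈q)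

⊆∧≢⇒⊂ : ∀ {n} {p q : Subset n} → p ⊆ q → p ≢ q → p ⊂ q
⊆∧≢⇒⊂ {p = []}          {[]}          _   p≢q = ⊥-elim (p≢q refl)
⊆∧≢⇒⊂ {p = inside ∷ p}  {outside ∷ q} p⊆q _   = contradiction (p⊆q here) λ ()
⊆∧≢⇒⊂ {p = outside ∷ p} {inside ∷ q}  p⊆q _   = out⊂in (drop-∷-⊆ p⊆q)
⊆∧≢⇒⊂ {p = inside ∷ p}  {inside ∷ q}  p⊆q p≢q = s⊂s (⊆∧≢⇒⊂ (drop-∷-⊆ p⊆q) (p≢q ∘ cong (inside ∷_)))
⊆∧≢⇒⊂ {p = outside ∷ p} {outside ∷ q} p⊆q p≢q = s⊂s (⊆∧≢⇒⊂ (drop-∷-⊆ p⊆q) (p≢q ∘ cong (outside ∷_)))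

⊂-wellFounded : ∀ {n} → WellFounded (_⊂_ {n})
⊂-wellFounded = Subrelation.wellFounded p⊂q⇒∣p∣<∣q∣ (On.wellFounded ∣_∣ <-wellFounded)

⊃-wellFounded : ∀ {n} → WellFounded (_⊃_ {n})
⊃-wellFounded = Subrelation.wellFounded (p⊂q⇒∣p∣<∣q∣ ∘ p⊂q⇒∁p⊃∁q) (On.wellFounded (∣_∣ ∘ ∁) <-wellFounded)

¬¬-∀-subset : ∀ {n} {P : Pred (Subset n) 0ℓ} → (∀ S → ¬ ¬ P S) → ¬ ¬ (∀ S → P S)
¬¬-∀-subset {zero} h = do
  p ← h []
  return λ { [] → p }
¬¬-∀-subset {suc n} h = do
  p-in ← ¬¬-∀-subset (h ∘ (inside ∷_))
  p-out ← ¬¬-∀-subset (h ∘ (outside ∷_))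
  return λ { (inside ∷ S) → p-in S ; (outside ∷ S) → p-out S }

module ⊆-Exposure (n : ℕ) = Exposure (⊆-isPartialOrder n)
  (Subrelation.wellFounded (uncurry ⊆∧≢⇒⊂) ⊂-wellFounded)
  (Subrelation.wellFounded (uncurry ⊆∧≢⇒⊂) ⊃-wellFounded)
  ⋃ ⊆-⋃ ⋃-⊆

module ⊇-Exposure (n : ℕ) = Exposure (Flip.isPartialOrder (⊆-isPartialOrder n))
  (Subrelation.wellFounded (λ (q⊆p , p≢q) → ⊆∧≢⇒⊂ q⊆p (p≢q ∘ sym)) ⊃-wellFounded)
  (Subrelation.wellFounded (λ (p⊆q , q≢p) → ⊆∧≢⇒⊂ p⊆q (q≢p ∘ sym)) ⊂-wellFounded)
  ⋂ ⋂-⊆ ⊆-⋂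

containsCopy-✶⇔stacked : ∀ {n R Q} {F : Family n} → ContainsCopy F (Q ✶ R) ⇔ Stacked _⊆_ R Q (_∈ F)
containsCopy-✶⇔stacked {n} = copy-✶⇔stacked ⇔-∘ containsCopy⇔copy
  where open Order (⊆-isPartialOrder n)

isSaturated⇔stackSaturated : ∀ {n R Q} {F : Family n} → IsSaturated n (Q ✶ R) F ⇔ IsStackSaturated _⊆_ R Q F
isSaturated⇔stackSaturated =
  mk⇔ (λ (unique , free , saturated) →
        unique , free ∘ from containsCopy-✶⇔stacked , λ S S∉F → to containsCopy-✶⇔stacked (saturated S S∉F))
      (λ (unique , free , saturated) →
        unique , free ∘ to containsCopy-✶⇔stacked , λ S S∉F → from containsCopy-✶⇔stacked (saturated S S∉F))
  where open Equivalence using (to; from)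

Shrinks : ℕ → FinRel → FinRel → Set
Shrinks n P P′ = ∀ {F} → IsSaturated n P F → ¬ ¬ (Σ (Family n) λ G → IsSaturated n P′ G × length G ≤ length F)

shrink-to-top : ∀ {n} P₁ P₂ → IsPartialOrder _≡_ (rel P₂) → ¬ HasUniqueMinimal P₂ →
  Shrinks n (P₂ ✶ P₁) (P₂ ✶ bullet)
shrink-to-top {n} P₁ P₂ po₂ noMin₂ saturated =
  Product.map₂ (Product.map₁ (Equivalence.from isSaturated⇔stackSaturated)) <$>
    ⊆-Exposure.stackSaturated-shrink n (≡-dec _≟ᵇ_) ¬¬-∀-subset (IsPartialOrder.antisym po₂) noMin₂
      (Equivalence.to isSaturated⇔stackSaturated saturated)

-- `HasUniqueMinimal (op P₁)` is `HasUniqueMaximal P₁`, and `op (op P₁)` is `P₁`, definitionally.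
shrink-to-bottom : ∀ {n} P₁ P₂ → IsPartialOrder _≡_ (rel P₁) → ¬ HasUniqueMaximal P₁ →
  Shrinks n (P₂ ✶ P₁) (bullet ✶ P₁)
shrink-to-bottom {n} P₁ P₂ po₁ noMax₁ saturated =
  Product.map₂ (Product.map₁ (Equivalence.from isSaturated⇔stackSaturated ∘ stackSaturated-flip)) <$>
    ⊇-Exposure.stackSaturated-shrink n (≡-dec _≟ᵇ_) ¬¬-∀-subset (flip (IsPartialOrder.antisym po₁)) noMax₁
      (stackSaturated-flip (Equivalence.to isSaturated⇔stackSaturated saturated))

satStar-≤ : ∀ {n P P′ a c} → IsSatStar n P c → IsSatStar n P′ a → Shrinks n P P′ → a ≤ c
satStar-≤ {a = a} ((F , saturated , refl) , _) (_ , a-least) shrink = decidable-stable (a ≤? length F) do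
  (G , saturated-G , G≤F) ← shrink saturated
  return (≤-trans (a-least G saturated-G) G≤F)

proposition2p4 : (P₁ P₂ : FinRel)
    → IsPartialOrder _≡_ (rel P₁) → IsPartialOrder _≡_ (rel P₂)
    → 1 ≤ size P₁ → 1 ≤ size P₂
    → ¬ HasUniqueMaximal P₁ → ¬ HasUniqueMinimal P₂
    → (n a b c : ℕ)
    → IsSatStar n (P₂ ✶ P₁) c
    → IsSatStar n (P₂ ✶ bullet) a
    → IsSatStar n (bullet ✶ P₁) b
    → a ⊔ b ≤ c
proposition2p4 P₁ P₂ po₁ po₂ _ _ noMax₁ noMin₂ n a b c sat-c sat-a sat-b =
  ⊔-lub (satStar-≤ sat-c sat-a (shrink-to-top P₁ P₂ po₂ noMin₂))
        (satStar-≤ sat-c sat-b (shrink-to-bottom P₁ P₂ po₁ noMax₁))
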